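{- Let $t\ge 1$ be an integer. Then ${\rm forb}(m,\{F_{0,2,2,0},\,t\cdot F_{0,2,1,0}\})$ is $O(m)$ as $m\to\infty$.
   Context: A matrix is simple if it is a (0,1)-matrix with no repeated columns. For (0,1)-matrices $F$ and $A$, $F\prec A$ means some row and column permutation of $F$ is a submatrix of $A$. For a finite family $\mathcal F$ of (0,1)-matrices, ${\rm forb}(m,\mathcal F)$ is the maximum number of columns of an $m$-rowed simple matrix $A$ with $F\not\prec A$ for every $F\in\mathcal F$. $t\cdot M$ denotes the concatenation of $t$ copies of $M$. $F_{e,f,g,h}$ denotes the $(e+f+g+h)\times 2$ (0,1)-matrix with $e$ rows $[1\,1]$, $f$ rows $[1\,0]$, $g$ rows $[0\,1]$ and $h$ rows $[0\,0]$. -}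

module Defs where

open import Data.Nat using (ℕ; zero; suc; _+_; _*_; _<ᵇ_)
open import Data.Fin using (Fin; toℕ; splitAt)
open import Data.Bool using (Bool; true; false; if_then_else_)
open import Data.Sum using (inj₁; inj₂)
open import Data.Product using (Σ; ∃; _×_; _,_)
open import Relation.Binary.PropositionalEquality using (_≡_)
open import Function.Definitions using (Injective)
open import Relation.Nullary using (¬_)

Mat : ℕ → ℕ → Set
Mat m n = Fin m → Fin n → Bool

Simple : ∀ {m n} → Mat m n → Set
Simple {m} {n} A = ∀ (j j' : Fin n) → (∀ (i : Fin m) → A i j ≡ A i j') → j ≡ j'

-- F ≺ A : some row and column permutation of F is a submatrix of A,
-- i.e. there are injective maps of rows and columns of F into those of A
-- preserving entries.
_≺_ : ∀ {k l m n} → Mat k l → Mat m n → Set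
_≺_ {k} {l} {m} {n} F A =
  Σ (Fin k → Fin m) λ r → Σ (Fin l → Fin n) λ c →
    Injective _≡_ _≡_ r × Injective _≡_ _≡_ c × (∀ i j → F i j ≡ A (r i) (c j))

concat : ∀ {k l l'} → Mat k l → Mat k l' → Mat k (l + l')
concat {l = l} M N i j with splitAt l j
... | inj₁ j₁ = M i j₁
... | inj₂ j₂ = N i j₂

_·_ : ∀ {k l} → (t : ℕ) → Mat k l → Mat k (t * l)
zero · M = λ _ ()
suc t · M = concat M (t · M)

-- F_{e,f,g,h}: e rows [1 1], then f rows [1 0], then g rows [0 1], then h rows [0 0]
F : (e f g h : ℕ) → Mat (e + f + g + h) 2
F e f g h i j =
  if toℕ i <ᵇ e then true
  else if toℕ i <ᵇ e + f then first j
  else if toℕ i <ᵇ e + f + g then second j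
  else false
  where
    first : Fin 2 → Bool
    first Fin.zero = true
    first _ = false
    second : Fin 2 → Bool
    second Fin.zero = false
    second _ = true

-- Two columns of the same size that differ must differ by a single exchange j − a + b,
-- for otherwise they form F_{0,2,2,0}.  Call j x-heavy if x ∈ j and j − x + y is a column
-- for at least t + 2 rows y ∉ j.  Two x-heavy columns of equal size coincide, and an x-heavy
-- column lies inside every x-heavy column at least two larger.  So the x-heavy columns whose
-- sizes have a fixed parity form a chain, and t + 1 of them below an x-heavy column j would,
-- with t exchanges of j at x, give t·F_{0,2,1,0} on x and two rows of j outside the largest
-- of them.  Hence an x-heavy column is determined by x, the parity of its size and its
-- position (at most t) in that chain; the same holds for the heavy columns of the complement.
-- A column j with t + 3 other columns of its size is heavy in A or in the complement: any two
-- of the exchanges j − a_p + b_p share a or share b (else F_{0,2,2,0}), so all share a or all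
-- share b.  Every other column is determined by its size and its position (at most t + 2)
-- among the earlier columns of that size.

module Submission where

open import Defs
open import Data.Nat using (ℕ; zero; suc; _≤_; _<_; _+_; _*_; z≤n; s≤s; s≤s⁻¹; _≤?_; _<?_)
open import Data.Nat.Properties
open import Data.Nat.Tactic.RingSolver using (solve-∀)
open import Data.Fin as Fin using (Fin; zero; suc; toℕ; punchIn; splitAt; join; combine; remQuot; fromℕ<)
import Data.Fin.Properties as Finₚ
open import Data.Bool using (Bool; true; false; not; _∧_; if_then_else_)
open import Data.Bool.Properties using (∧-comm; not-injective) renaming (_≟_ to _≟ᵇ_)
import Data.Product as Product
open import Data.Product using (Σ; ∃; ∃₂; _×_; _,_; proj₁; proj₂; uncurry)
open import Data.Sum using (_⊎_; inj₁; inj₂; [_,_]′; map₂)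
open import Data.Sum.Properties using (inj₁-injective; inj₂-injective)
open import Data.Vec.Functional using (_∷_; []; _++_)
open import Function using (_∘_)
open import Function.Definitions using (Injective)
open import Relation.Nullary using (¬_; Dec; yes; no; does; contradiction)
open import Relation.Nullary.Decidable using (dec-true; dec-false; _×-dec_; _⊎-dec_; ¬?)
open import Relation.Binary.PropositionalEquality
open import Relation.Binary.Definitions using (tri<; tri≈; tri>; DecidableEquality)

does-sound : ∀ {a} {A : Set a} (a? : Dec A) → does a? ≡ true → A
does-sound (yes a) _ = a

module _ {a} {A : Set a} where

  ∷-injective : ∀ {k} {x : A} {g : Fin k → A} → Injective _≡_ _≡_ g → (∀ i → g i ≢ x) →
                Injective _≡_ _≡_ (x ∷ g)
  ∷-injective g-inj g≢x {zero}  {zero}  _ = refl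
  ∷-injective g-inj g≢x {zero}  {suc j} e = contradiction (sym e) (g≢x j)
  ∷-injective g-inj g≢x {suc i} {zero}  e = contradiction e (g≢x i)
  ∷-injective g-inj g≢x {suc i} {suc j} e = cong suc (g-inj e)

  pair-injective : ∀ {x y : A} → x ≢ y → Injective _≡_ _≡_ (x ∷ y ∷ [])
  pair-injective x≢y = ∷-injective (∷-injective (λ {}) (λ ())) (λ { zero → x≢y ∘ sym ; (suc ()) })

  ++-injective : ∀ {k l} {f : Fin k → A} {g : Fin l → A} →
                 Injective _≡_ _≡_ f → Injective _≡_ _≡_ g → (∀ i j → f i ≢ g j) →
                 Injective _≡_ _≡_ (f ++ g)
  ++-injective {k} {l} {f} {g} f-inj g-inj disjoint {i} {j} e = begin
    i                      ≡⟨ Finₚ.join-splitAt k l i ⟨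
    join k l (splitAt k i) ≡⟨ cong (join k l) (on-sums (splitAt k i) (splitAt k j) e) ⟩
    join k l (splitAt k j) ≡⟨ Finₚ.join-splitAt k l j ⟩
    j                      ∎
    where
    open ≡-Reasoning
    on-sums : ∀ u v → [ f , g ]′ u ≡ [ f , g ]′ v → u ≡ v
    on-sums (inj₁ u) (inj₁ v) e = cong inj₁ (f-inj e)
    on-sums (inj₁ u) (inj₂ v) e = contradiction e (disjoint u v)
    on-sums (inj₂ u) (inj₁ v) e = contradiction (sym e) (disjoint v u)
    on-sums (inj₂ u) (inj₂ v) e = cong inj₂ (g-inj e)

join-injective : ∀ k l → Injective _≡_ _≡_ (join k l)
join-injective k l {u} {v} e =
  trans (sym (Finₚ.splitAt-join k l u)) (trans (cong (splitAt k) e) (Finₚ.splitAt-join k l v))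

fromℕ<-injective : ∀ {a b k} (a<k : a < k) (b<k : b < k) → fromℕ< a<k ≡ fromℕ< b<k → a ≡ b
fromℕ<-injective a<k b<k e = trans (sym (Finₚ.toℕ-fromℕ< a<k)) (trans (cong toℕ e) (Finₚ.toℕ-fromℕ< b<k))

join₃-injective : ∀ k l r → Injective _≡_ _≡_ (join k (l + r) ∘ map₂ (join l r))
join₃-injective k l r {u} {v} e = on-sums u v (join-injective k (l + r) e)
  where
  on-sums : ∀ u v → map₂ (join l r) u ≡ map₂ (join l r) v → u ≡ v
  on-sums (inj₁ u) (inj₁ v) e = cong inj₁ (inj₁-injective e)
  on-sums (inj₂ u) (inj₂ v) e = cong inj₂ (join-injective l r (inj₂-injective e))
  on-sums (inj₁ _) (inj₂ _) ()
  on-sums (inj₂ _) (inj₁ _) ()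

remQuot-injective : ∀ {k} l → Injective _≡_ _≡_ (remQuot {k} l)
remQuot-injective {k} l {p} {q} e = begin
  p                                  ≡⟨ Finₚ.combine-remQuot {k} l p ⟨
  uncurry combine (remQuot {k} l p) ≡⟨ cong (uncurry combine) e ⟩
  uncurry combine (remQuot {k} l q) ≡⟨ Finₚ.combine-remQuot {k} l q ⟩
  q                                  ∎
  where open ≡-Reasoning

-- Counting

count : ∀ {k} → (Fin k → Bool) → ℕ
count {zero}  p = 0
count {suc k} p = (if p zero then 1 else 0) + count (p ∘ suc)

module _ {k : ℕ} where

  infixl 6 _∖_
  infix 4 _⊆_

  _⊆_ : (Fin k → Bool) → (Fin k → Bool) → Set
  p ⊆ q = ∀ i → p i ≡ true → q i ≡ true

  _∩_ _∖_ : (Fin k → Bool) → (Fin k → Bool) → Fin k → Bool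
  (p ∩ q) i = p i ∧ q i
  (p ∖ q) i = p i ∧ not (q i)

  ⁅_⁆ : Fin k → Fin k → Bool
  ⁅ x ⁆ i = does (i Fin.≟ x)

  ∖-intro : ∀ (p q : Fin k → Bool) {i} → p i ≡ true → q i ≡ false → (p ∖ q) i ≡ true
  ∖-intro p q pi qi rewrite pi | qi = refl

  ∖-elim : ∀ (p q : Fin k → Bool) {i} → (p ∖ q) i ≡ true → p i ≡ true × q i ≡ false
  ∖-elim p q {i} e with p i | q i
  ... | true | false = refl , refl

  ⊆-false : ∀ {p q : Fin k → Bool} → p ⊆ q → ∀ {i} → q i ≡ false → p i ≡ false
  ⊆-false {p = p} p⊆q {i} qi with p i in pi
  ... | false = refl
  ... | true  = contradiction (trans (sym (p⊆q i pi)) qi) λ ()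

count-cong : ∀ {k} {p q : Fin k → Bool} → (∀ i → p i ≡ q i) → count p ≡ count q
count-cong {zero}  eq = refl
count-cong {suc k} eq = cong₂ _+_ (cong (λ b → if b then 1 else 0) (eq zero)) (count-cong (eq ∘ suc))

count-mono : ∀ {k} {p q : Fin k → Bool} → p ⊆ q → count p ≤ count q
count-mono {zero}              p⊆q = z≤n
count-mono {suc k} {p} {q} p⊆q = +-mono-≤ head (count-mono (p⊆q ∘ suc))
  where
  head : (if p zero then 1 else 0) ≤ (if q zero then 1 else 0)
  head with p zero | p⊆q zero
  ... | false | _ = z≤n
  ... | true  | q0 rewrite q0 refl = ≤-refl

count-≤ : ∀ {k} (p : Fin k → Bool) → count p ≤ k
count-≤ {zero}  p = z≤n
count-≤ {suc k} p with p zero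
... | true  = s≤s (count-≤ (p ∘ suc))
... | false = m≤n⇒m≤1+n (count-≤ (p ∘ suc))

count-split : ∀ {k} (p q : Fin k → Bool) → count p ≡ count (p ∩ q) + count (p ∖ q)
count-split {zero}  p q = refl
count-split {suc k} p q with p zero | q zero
... | false | _     = count-split (p ∘ suc) (q ∘ suc)
... | true  | true  = cong suc (count-split (p ∘ suc) (q ∘ suc))
... | true  | false = trans (cong suc (count-split (p ∘ suc) (q ∘ suc))) (sym (+-suc _ _))

count-remove : ∀ {k} (p : Fin k → Bool) {x} → p x ≡ true → count p ≡ suc (count (p ∖ ⁅ x ⁆))
count-remove p {zero} px rewrite px = cong suc (count-cong (λ i → sym (∧-comm (p (suc i)) true)))
count-remove {suc k} p {suc x} px with p zero
... | true  = cong suc (count-remove (p ∘ suc) px)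
... | false = count-remove (p ∘ suc) px

count-⊂ : ∀ {k} {p q : Fin k → Bool} {z} → p ⊆ q → q z ≡ true → p z ≡ false → count p < count q
count-⊂ {p = p} {q} {z} p⊆q qz pz = subst (count p <_) (sym (count-remove q qz)) (s≤s (count-mono p⊆q∖z))
  where
  p⊆q∖z : p ⊆ q ∖ ⁅ z ⁆
  p⊆q∖z i pi with i Fin.≟ z
  ... | yes refl = contradiction (trans (sym pi) pz) λ ()
  ... | no _     = cong (_∧ true) (p⊆q i pi)

abstract
  count-witness : ∀ {k} (p : Fin k → Bool) → 0 < count p → ∃ λ x → p x ≡ true
  count-witness {suc k} p pos with p zero in p0
  ... | true  = zero , p0
  ... | false with x , px ← count-witness (p ∘ suc) pos = suc x , px

  injection⇒≤count : ∀ {k n} (p : Fin n → Bool) (f : Fin k → Fin n) →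
                     Injective _≡_ _≡_ f → (∀ a → p (f a) ≡ true) → k ≤ count p
  injection⇒≤count {zero}  p f f-inj f∈p = z≤n
  injection⇒≤count {suc k} p f f-inj f∈p =
    subst (suc k ≤_) (sym (count-remove p (f∈p zero)))
      (s≤s (injection⇒≤count (p ∖ ⁅ f zero ⁆) (f ∘ suc) (Finₚ.suc-injective ∘ f-inj) rest))
    where
    rest : ∀ a → (p ∖ ⁅ f zero ⁆) (f (suc a)) ≡ true
    rest a = ∖-intro p ⁅ f zero ⁆ (f∈p (suc a)) (dec-false (f (suc a) Fin.≟ f zero) (λ e → Finₚ.0≢1+n (f-inj (sym e))))

  ≤count⇒injection : ∀ {k n} (p : Fin n → Bool) → k ≤ count p →
                     Σ (Fin k → Fin n) λ f → Injective _≡_ _≡_ f × (∀ a → p (f a) ≡ true)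
  ≤count⇒injection {zero}  p _ = (λ ()) , (λ {}) , (λ ())
  ≤count⇒injection {suc k} p k<count with count-witness p (≤-trans (s≤s z≤n) k<count)
  ... | x , px with ≤count⇒injection (p ∖ ⁅ x ⁆) (s≤s⁻¹ (subst (suc k ≤_) (count-remove p px) k<count))
  ... | g , g-inj , g∈p∖x = x ∷ g , ∷-injective g-inj g≢x , x∷g∈p
    where
    g≢x : ∀ a → g a ≢ x
    g≢x a e = contradiction (trans (sym (dec-true (g a Fin.≟ x) e)) (proj₂ (∖-elim p ⁅ x ⁆ (g∈p∖x a)))) λ ()
    x∷g∈p : ∀ a → p ((x ∷ g) a) ≡ true
    x∷g∈p zero    = px
    x∷g∈p (suc a) = proj₁ (∖-elim p ⁅ x ⁆ (g∈p∖x a))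

witness⇒0<count : ∀ {k} (p : Fin k → Bool) {x} → p x ≡ true → 0 < count p
witness⇒0<count p {x} px = injection⇒≤count p (λ _ → x) (λ { {zero} {zero} _ → refl }) (λ _ → px)

distinct⇒2≤count : ∀ {k} (p : Fin k → Bool) {a b} → p a ≡ true → p b ≡ true → a ≢ b → 2 ≤ count p
distinct⇒2≤count p pa pb a≢b =
  injection⇒≤count p (_ ∷ _ ∷ []) (pair-injective a≢b) λ { zero → pa ; (suc zero) → pb }

2≤count⇒distinct : ∀ {k} (p : Fin k → Bool) → 2 ≤ count p →
                   ∃₂ λ a b → p a ≡ true × p b ≡ true × a ≢ b
2≤count⇒distinct p 2≤count with ≤count⇒injection p 2≤count
... | f , f-inj , f∈p = f zero , f (suc zero) , f∈p zero , f∈p (suc zero) , Finₚ.0≢1+n ∘ f-inj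

2≤count⇒avoiding : ∀ {k} (p : Fin k → Bool) → 2 ≤ count p → ∀ b → ∃ λ a → p a ≡ true × a ≢ b
2≤count⇒avoiding p 2≤count b with a , a' , pa , pa' , a≢a' ← 2≤count⇒distinct p 2≤count | a Fin.≟ b
... | no a≢b  = a , pa , a≢b
... | yes refl = a' , pa' , a≢a' ∘ sym

count-∖-sym : ∀ {k} (p q : Fin k → Bool) → count p ≡ count q → count (p ∖ q) ≡ count (q ∖ p)
count-∖-sym p q p≡q = +-cancelˡ-≡ (count (p ∩ q)) _ _ (begin
  count (p ∩ q) + count (p ∖ q) ≡⟨ count-split p q ⟨
  count p                       ≡⟨ p≡q ⟩
  count q                       ≡⟨ count-split q p ⟩
  count (q ∩ p) + count (q ∖ p) ≡⟨ cong (_+ count (q ∖ p)) (count-cong λ i → ∧-comm (q i) (p i)) ⟩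
  count (p ∩ q) + count (q ∖ p) ∎)
  where open ≡-Reasoning

count-≤-∖ : ∀ {k} (p q : Fin k → Bool) → count q ≤ count p + count (q ∖ p)
count-≤-∖ p q = begin
  count q                       ≡⟨ count-split q p ⟩
  count (q ∩ p) + count (q ∖ p) ≤⟨ +-monoˡ-≤ _ (count-mono q∩p⊆p) ⟩
  count p + count (q ∖ p)       ∎
  where
  open ≤-Reasoning
  q∩p⊆p : q ∩ p ⊆ p
  q∩p⊆p i e with q i | p i
  ... | true | true = refl

module _ {k : ℕ} where

  swap : (Fin k → Bool) → Fin k → Fin k → Fin k → Bool
  swap S x y i = if does (i Fin.≟ x) then false else if does (i Fin.≟ y) then true else S i

  swap-at-x : ∀ S x y → swap S x y x ≡ false
  swap-at-x S x y with x Fin.≟ x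
  ... | yes _  = refl
  ... | no x≢x = contradiction refl x≢x

  swap-at-y : ∀ S {x y} → y ≢ x → swap S x y y ≡ true
  swap-at-y S {x} {y} y≢x with y Fin.≟ x | y Fin.≟ y
  ... | yes y≡x | _      = contradiction y≡x y≢x
  ... | no _    | yes _  = refl
  ... | no _    | no y≢y = contradiction refl y≢y

  swap-elsewhere : ∀ S {x y i} → i ≢ x → i ≢ y → swap S x y i ≡ S i
  swap-elsewhere S {x} {y} {i} i≢x i≢y with i Fin.≟ x | i Fin.≟ y
  ... | yes i≡x | _       = contradiction i≡x i≢x
  ... | no _    | yes i≡y = contradiction i≡y i≢y
  ... | no _    | no _    = refl

  count-swap : ∀ S {x y} → S x ≡ true → S y ≡ false → count (swap S x y) ≡ count S
  count-swap S {x} {y} Sx Sy = begin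
    count (swap S x y)                ≡⟨ count-remove (swap S x y) (swap-at-y S y≢x) ⟩
    suc (count (swap S x y ∖ ⁅ y ⁆)) ≡⟨ cong suc (count-cong same) ⟩
    suc (count (S ∖ ⁅ x ⁆))          ≡⟨ count-remove S Sx ⟨
    count S                           ∎
    where
    open ≡-Reasoning
    y≢x : y ≢ x
    y≢x refl = contradiction (trans (sym Sx) Sy) λ ()
    same : ∀ i → (swap S x y ∖ ⁅ y ⁆) i ≡ (S ∖ ⁅ x ⁆) i
    same i with i Fin.≟ x | i Fin.≟ y
    ... | yes refl | _        = cong (_∧ false) (sym Sx)
    ... | no _     | yes refl = cong (_∧ true) (sym Sy)
    ... | no _     | no _     = refl

  not-swap : ∀ S {x y} → x ≢ y → ∀ i → not (swap S x y i) ≡ swap (not ∘ S) y x i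
  not-swap S {x} {y} x≢y i with i Fin.≟ x | i Fin.≟ y
  ... | yes refl | yes refl = contradiction refl x≢y
  ... | yes refl | no _     = refl
  ... | no _     | yes refl = refl
  ... | no _     | no _     = refl

abstract
  argmax : ∀ {k} (f : Fin (suc k) → ℕ) → ∃ λ i → ∀ j → f j ≤ f i
  argmax {zero}  f = zero , λ { zero → ≤-refl }
  argmax {suc k} f with argmax (f ∘ suc)
  ... | i , max with f zero ≤? f (suc i)
  ... | yes f0≤ = suc i , λ { zero → f0≤ ; (suc j) → max j }
  ... | no  f0≰ = zero  , λ { zero → ≤-refl ; (suc j) → ≤-trans (max j) (<⇒≤ (≰⇒> f0≰)) }

parity : ℕ → Fin 2
parity zero          = zero
parity (suc zero)    = suc zero
parity (suc (suc n)) = parity n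

parity-suc : ∀ n → parity (suc n) ≢ parity n
parity-suc zero          ()
parity-suc (suc zero)    ()
parity-suc (suc (suc n)) = parity-suc n

same-parity⇒2+≤ : ∀ {m n} → m < n → parity m ≡ parity n → 2 + m ≤ n
same-parity⇒2+≤ {m} {suc n} (s≤s m≤n) same with m≤n⇒m<n∨m≡n m≤n
... | inj₁ m<n  = s≤s m<n
... | inj₂ refl = contradiction (sym same) (parity-suc m)

module _ {a b} {X : Set a} {Y : Set b} where

  pairwise-sharing⇒common : ∀ {k} → DecidableEquality X → (f : Fin (suc k) → X) (g : Fin (suc k) → Y) →
                            (∀ p q → f p ≡ f q ⊎ g p ≡ g q) → (∀ p → f p ≡ f zero) ⊎ (∀ p → g p ≡ g zero)
  pairwise-sharing⇒common _≟_ f g share with Finₚ.all? (λ p → f p ≟ f zero)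
  ... | yes all-f = inj₁ all-f
  ... | no ¬all-f with q , fq≢f0 ← Finₚ.¬∀⟶∃¬ _ _ (λ p → f p ≟ f zero) ¬all-f = inj₂ all-g
    where
    gq≡g0 : g q ≡ g zero
    gq≡g0 = [ (λ fq≡f0 → contradiction fq≡f0 fq≢f0) , (λ e → e) ]′ (share q zero)
    all-g : ∀ p → g p ≡ g zero
    all-g p with share p zero | share p q
    ... | inj₂ gp≡g0 | _          = gp≡g0
    ... | inj₁ fp≡f0 | inj₁ fp≡fq = contradiction (trans (sym fp≡fq) fp≡f0) fq≢f0
    ... | inj₁ _     | inj₂ gp≡gq = trans gp≡gq gq≡g0

module Rank {k ℓ} {_⊏_ : Fin k → Fin k → Set ℓ} (_⊏?_ : ∀ i j → Dec (i ⊏ j))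
            (⊏-trans : ∀ {i j l} → i ⊏ j → j ⊏ l → i ⊏ l) (⊏-irrefl : ∀ {i} → ¬ i ⊏ i) where

  rank : Fin k → ℕ
  rank j = count λ i → does (i ⊏? j)

  rank-mono : ∀ {i j} → i ⊏ j → rank i < rank j
  rank-mono {i} {j} i⊏j = count-⊂ {z = i}
    (λ l l⊏i → dec-true (l ⊏? j) (⊏-trans (does-sound (l ⊏? i) l⊏i) i⊏j))
    (dec-true (i ⊏? j) i⊏j) (dec-false (i ⊏? i) ⊏-irrefl)

  rank-injective : ∀ {i j} → i ⊏ j ⊎ i ≡ j ⊎ j ⊏ i → rank i ≡ rank j → i ≡ j
  rank-injective (inj₁ i⊏j)        e = contradiction e (<⇒≢ (rank-mono i⊏j))
  rank-injective (inj₂ (inj₁ i≡j)) _ = i≡j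
  rank-injective (inj₂ (inj₂ j⊏i)) e = contradiction (sym e) (<⇒≢ (rank-mono j⊏i))

  predecessors : ∀ {r j} → r ≤ rank j → Σ (Fin r → Fin k) λ f → Injective _≡_ _≡_ f × (∀ a → f a ⊏ j)
  predecessors {j = j} r≤rank with ≤count⇒injection _ r≤rank
  ... | f , f-inj , f⊏j = f , f-inj , λ a → does-sound (f a ⊏? j) (f⊏j a)

-- The forbidden configurations

column : ∀ {m n} → Mat m n → Fin n → Fin m → Bool
column B j i = B i j

Crossing : ∀ {m n} → Mat m n → Fin n → Fin n → Set
Crossing B j j' = 2 ≤ count (column B j ∖ column B j') × 2 ≤ count (column B j' ∖ column B j)

crossing⇒F0220≺ : ∀ {m n} {B : Mat m n} {j j'} → Crossing B j j' → F 0 2 2 0 ≺ B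
crossing⇒F0220≺ {B = B} {j} {j'} (j∖j' , j'∖j)
  with f , f-inj , f∈ ← ≤count⇒injection _ j∖j' | g , g-inj , g∈ ← ≤count⇒injection _ j'∖j =
  f ++ g , (j ∷ j' ∷ []) , ++-injective f-inj g-inj f≢g , pair-injective j≢j' , entries
  where
  f-in  = λ u → proj₁ (∖-elim (column B j) (column B j') (f∈ u))
  f-out = λ u → proj₂ (∖-elim (column B j) (column B j') (f∈ u))
  g-in  = λ u → proj₁ (∖-elim (column B j') (column B j) (g∈ u))
  g-out = λ u → proj₂ (∖-elim (column B j') (column B j) (g∈ u))
  f≢g : ∀ u v → f u ≢ g v
  f≢g u v e = contradiction (trans (sym (f-in u)) (trans (cong (λ r → B r j) e) (g-out v))) λ ()
  j≢j' : j ≢ j'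
  j≢j' e = contradiction (trans (sym (f-in zero)) (trans (cong (B (f zero)) e) (f-out zero))) λ ()
  entries : ∀ i c → F 0 2 2 0 i c ≡ B ((f ++ g) i) ((j ∷ j' ∷ []) c)
  entries zero                   zero       = sym (f-in zero)
  entries zero                   (suc zero) = sym (f-out zero)
  entries (suc zero)             zero       = sym (f-in (suc zero))
  entries (suc zero)             (suc zero) = sym (f-out (suc zero))
  entries (suc (suc zero))       zero       = sym (g-out zero)
  entries (suc (suc zero))       (suc zero) = sym (g-in zero)
  entries (suc (suc (suc zero))) zero       = sym (g-out (suc zero))
  entries (suc (suc (suc zero))) (suc zero) = sym (g-in (suc zero))

record Repeated-F0210 {m n} (t : ℕ) (B : Mat m n) : Set where
  field
    row₁ row₂ row₃ : Fin m
    row₁≢row₂ : row₁ ≢ row₂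
    row₁≢row₃ : row₁ ≢ row₃
    row₂≢row₃ : row₂ ≢ row₃
    upper lower : Fin t → Fin n
    upper-injective : Injective _≡_ _≡_ upper
    lower-injective : Injective _≡_ _≡_ lower
    upper₁ : ∀ p → B row₁ (upper p) ≡ true
    upper₂ : ∀ p → B row₂ (upper p) ≡ true
    upper₃ : ∀ p → B row₃ (upper p) ≡ false
    lower₁ : ∀ p → B row₁ (lower p) ≡ false
    lower₂ : ∀ p → B row₂ (lower p) ≡ false
    lower₃ : ∀ p → B row₃ (lower p) ≡ true

·-entry : ∀ {k l} t (M : Mat k l) i p → (t · M) i p ≡ M i (proj₂ (remQuot {t} l p))
·-entry {l = l} (suc t) M i p with splitAt l p
... | inj₁ q = refl
... | inj₂ q = ·-entry t M i q

repeated-F0210⇒≺ : ∀ {m n t} {B : Mat m n} → Repeated-F0210 t B → (t · F 0 2 1 0) ≺ B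
repeated-F0210⇒≺ {m} {n} {t} {B} R =
  rows , columns , rows-injective , columns-injective , entries
  where
  open Repeated-F0210 R
  rows : Fin 3 → Fin m
  rows = row₁ ∷ row₂ ∷ row₃ ∷ []
  rows-injective : Injective _≡_ _≡_ rows
  rows-injective = ∷-injective (pair-injective row₂≢row₃)
    λ { zero → row₁≢row₂ ∘ sym ; (suc zero) → row₁≢row₃ ∘ sym }
  pick : Fin t × Fin 2 → Fin n
  pick (u , zero)     = upper u
  pick (u , suc zero) = lower u
  pick-injective : Injective _≡_ _≡_ pick
  pick-injective {u , zero}     {v , zero}     e = cong (_, zero) (upper-injective e)
  pick-injective {u , suc zero} {v , suc zero} e = cong (_, suc zero) (lower-injective e)
  pick-injective {u , zero}     {v , suc zero} e =
    contradiction (trans (sym (upper₃ u)) (trans (cong (B row₃) e) (lower₃ v))) λ ()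
  pick-injective {u , suc zero} {v , zero}     e =
    contradiction (trans (sym (upper₃ v)) (trans (cong (B row₃) (sym e)) (lower₃ u))) λ ()
  columns : Fin (t * 2) → Fin n
  columns = pick ∘ remQuot {t} 2
  columns-injective : Injective _≡_ _≡_ columns
  columns-injective = remQuot-injective 2 ∘ pick-injective
  copy : ∀ i u c → F 0 2 1 0 i c ≡ B (rows i) (pick (u , c))
  copy zero             u zero       = sym (upper₁ u)
  copy zero             u (suc zero) = sym (lower₁ u)
  copy (suc zero)       u zero       = sym (upper₂ u)
  copy (suc zero)       u (suc zero) = sym (lower₂ u)
  copy (suc (suc zero)) u zero       = sym (upper₃ u)
  copy (suc (suc zero)) u (suc zero) = sym (lower₃ u)
  entries : ∀ i p → (t · F 0 2 1 0) i p ≡ B (rows i) (columns p)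
  entries i p = trans (·-entry t (F 0 2 1 0) i p) (copy i (proj₁ (remQuot {t} 2 p)) (proj₂ (remQuot {t} 2 p)))

complement : ∀ {m n} → Mat m n → Mat m n
complement B i j = not (B i j)

not-≡-swap : ∀ {a b} → not a ≡ b → a ≡ not b
not-≡-swap {true}  refl = refl
not-≡-swap {false} refl = refl

module _ {m n} {B : Mat m n} where

  complement-simple : Simple B → Simple (complement B)
  complement-simple simple j j' same = simple j j' (λ i → not-injective (same i))

  complement-crossing : ∀ {j j'} → Crossing (complement B) j j' → Crossing B j' j
  complement-crossing (j∖j' , j'∖j) = subst (2 ≤_) (count-cong (flip _ _)) j∖j' , subst (2 ≤_) (count-cong (flip _ _)) j'∖j
    where
    flip : ∀ j j' i → (column (complement B) j ∖ column (complement B) j') i ≡ (column B j' ∖ column B j) i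
    flip j j' i with B i j | B i j'
    ... | true  | true  = refl
    ... | true  | false = refl
    ... | false | true  = refl
    ... | false | false = refl

  complement-repeated : ∀ {t} → Repeated-F0210 t (complement B) → Repeated-F0210 t B
  complement-repeated R = record
    { row₁ = row₁ ; row₂ = row₂ ; row₃ = row₃
    ; row₁≢row₂ = row₁≢row₂ ; row₁≢row₃ = row₁≢row₃ ; row₂≢row₃ = row₂≢row₃
    ; upper = lower ; lower = upper
    ; upper-injective = lower-injective ; lower-injective = upper-injective
    ; upper₁ = not-≡-swap ∘ lower₁ ; upper₂ = not-≡-swap ∘ lower₂ ; upper₃ = not-≡-swap ∘ lower₃
    ; lower₁ = not-≡-swap ∘ upper₁ ; lower₂ = not-≡-swap ∘ upper₂ ; lower₃ = not-≡-swap ∘ upper₃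
    }
    where open Repeated-F0210 R

-- Heavy columns

module HeavyColumns {m n} (t : ℕ) (B : Mat m n) (simple : Simple B)
                    (no-crossing : ∀ j j' → ¬ Crossing B j j')
                    (no-repeated : ¬ Repeated-F0210 t B) where

  col : Fin n → Fin m → Bool
  col = column B

  size : Fin n → ℕ
  size j = count (col j)

  equal-size-differ-once : ∀ {U V} → size U ≡ size V → ¬ 2 ≤ count (col U ∖ col V)
  equal-size-differ-once {U} {V} size≡ U∖V =
    no-crossing U V (U∖V , subst (2 ≤_) (count-∖-sym (col U) (col V) size≡) U∖V)

  unique-difference : ∀ {U V r r'} → size U ≡ size V →
                      B r U ≡ true → B r V ≡ false → B r' U ≡ true → B r' V ≡ false → r ≡ r'
  unique-difference {U} {V} {r} {r'} size≡ rU rV r'U r'V with r Fin.≟ r'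
  ... | yes r≡r' = r≡r'
  ... | no  r≢r' = contradiction
    (distinct⇒2≤count _ (∖-intro (col U) (col V) rU rV) (∖-intro (col U) (col V) r'U r'V) r≢r')
    (equal-size-differ-once size≡)

  distinct-columns-differ : ∀ {j j'} → j ≢ j' → ∃ λ r → B r j ≢ B r j'
  distinct-columns-differ {j} {j'} j≢j' =
    Finₚ.¬∀⟶∃¬ m _ (λ r → B r j ≟ᵇ B r j') (j≢j' ∘ simple j j')

  equal-size-difference : ∀ {j j'} → size j ≡ size j' → j ≢ j' → ∃ λ b → B b j' ≡ true × B b j ≡ false
  equal-size-difference {j} {j'} size≡ j≢j' =
    Product.map₂ (∖-elim (col j') (col j)) (count-witness _ nonempty)
    where
    nonempty : 1 ≤ count (col j' ∖ col j)
    nonempty with r , r-differs ← distinct-columns-differ j≢j' | B r j in rj | B r j' in rj'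
    ... | false | true  = witness⇒0<count (col j' ∖ col j) (∖-intro (col j') (col j) rj' rj)
    ... | true  | false = subst (1 ≤_) (count-∖-sym (col j) (col j') size≡)
                            (witness⇒0<count (col j ∖ col j') (∖-intro (col j) (col j') rj rj'))
    ... | true  | true  = contradiction refl r-differs
    ... | false | false = contradiction refl r-differs

  ≢-by-entry : ∀ {x y j} → B x j ≡ true → B y j ≡ false → x ≢ y
  ≢-by-entry xj yj refl = contradiction (trans (sym xj) yj) λ ()

  equal-size-exchange : ∀ {j j'} → size j ≡ size j' → j ≢ j' →
                        ∃₂ λ a b → B a j ≡ true × B b j ≡ false × col j' ≗ swap (col j) a b
  equal-size-exchange {j} {j'} size≡ j≢j'
    with b , bj' , bj ← equal-size-difference size≡ j≢j'
       | a , aj , aj' ← equal-size-difference (sym size≡) (j≢j' ∘ sym) = a , b , aj , bj , shape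
    where
    shape : ∀ i → B i j' ≡ swap (col j) a b i
    shape i with i Fin.≟ a | i Fin.≟ b
    ... | yes refl | _        = aj'
    ... | no _     | yes refl = bj'
    ... | no i≢a   | no i≢b   with B i j in ij | B i j' in ij'
    ... | true  | true  = refl
    ... | false | false = refl
    ... | true  | false = contradiction (unique-difference size≡ ij ij' aj aj') i≢a
    ... | false | true  = contradiction (unique-difference (sym size≡) ij' ij bj' bj) i≢b

  exchanges-differ-twice : ∀ {j U V a b a' b'} → B a j ≡ true → B b j ≡ false → B a' j ≡ true →
                           a ≢ a' → b ≢ b' → col U ≗ swap (col j) a b → col V ≗ swap (col j) a' b' →
                           2 ≤ count (col U ∖ col V)
  exchanges-differ-twice {j} {U} {V} {a} {b} {a'} {b'} aj bj a'j a≢a' b≢b' U≗ V≗ =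
    distinct⇒2≤count (col U ∖ col V) (∖-intro (col U) (col V) bU bV) (∖-intro (col U) (col V) a'U a'V)
      (≢-by-entry a'j bj ∘ sym)
    where
    bU : B b U ≡ true
    bU = trans (U≗ b) (swap-at-y (col j) (≢-by-entry aj bj ∘ sym))
    bV : B b V ≡ false
    bV = trans (V≗ b) (trans (swap-elsewhere (col j) (≢-by-entry a'j bj ∘ sym) b≢b') bj)
    a'U : B a' U ≡ true
    a'U = trans (U≗ a') (trans (swap-elsewhere (col j) (a≢a' ∘ sym) (≢-by-entry a'j bj)) a'j)
    a'V : B a' V ≡ false
    a'V = trans (V≗ a') (swap-at-x (col j) a' b')

  exchanges-share : ∀ {j U V a b a' b'} → B a j ≡ true → B b j ≡ false → B a' j ≡ true → B b' j ≡ false →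
                    col U ≗ swap (col j) a b → col V ≗ swap (col j) a' b' → a ≡ a' ⊎ b ≡ b'
  exchanges-share {a = a} {b} {a'} {b'} aj bj a'j b'j U≗ V≗ with a Fin.≟ a' | b Fin.≟ b'
  ... | yes a≡a' | _        = inj₁ a≡a'
  ... | no _     | yes b≡b' = inj₂ b≡b'
  ... | no a≢a'  | no b≢b'  = contradiction
    (exchanges-differ-twice aj bj a'j a≢a' b≢b' U≗ V≗ , exchanges-differ-twice a'j b'j aj (a≢a' ∘ sym) (b≢b' ∘ sym) V≗ U≗)
    (no-crossing _ _)

  Exchangeable : Fin n → Fin m → Fin m → Set
  Exchangeable j x y = B y j ≡ false × ∃ λ j' → col j' ≗ swap (col j) x y

  exchangeable? : ∀ j x y → Dec (Exchangeable j x y)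
  exchangeable? j x y =
    (B y j ≟ᵇ false) ×-dec Finₚ.any? (λ j' → Finₚ.all? (λ i → B i j' ≟ᵇ swap (col j) x y i))

  exchanges : Fin n → Fin m → Fin m → Bool
  exchanges j x y = does (exchangeable? j x y)

  N : ℕ
  N = 2 + t

  Heavy : Fin m → Fin n → Set
  Heavy x j = B x j ≡ true × N ≤ count (exchanges j x)

  heavy? : ∀ x j → Dec (Heavy x j)
  heavy? x j = (B x j ≟ᵇ true) ×-dec (N ≤? count (exchanges j x))

  many-exchanges⇒heavy : ∀ {k j x} → N ≤ k → B x j ≡ true →
                         (h : Fin k → Fin n) → Injective _≡_ _≡_ h → (y : Fin k → Fin m) →
                         (∀ p → B (y p) j ≡ false) → (∀ p → col (h p) ≗ swap (col j) x (y p)) → Heavy x j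
  many-exchanges⇒heavy {j = j} {x} N≤k xj h h-injective y y∉j h≗ =
    xj , ≤-trans N≤k (injection⇒≤count (exchanges j x) y y-injective
                       λ p → dec-true (exchangeable? j x (y p)) (y∉j p , h p , h≗ p))
    where
    y-injective : Injective _≡_ _≡_ y
    y-injective {p} {q} e = h-injective (simple (h p) (h q) λ i →
      trans (h≗ p i) (trans (cong (λ z → swap (col j) x z i) e) (sym (h≗ q i))))

  exchange-avoiding : ∀ {x j} → Heavy x j → ∀ b →
                      ∃₂ λ y T → y ≢ b × B y j ≡ false × col T ≗ swap (col j) x y
  exchange-avoiding {x} {j} (_ , N≤count) b
    with y , ey , y≢b ← 2≤count⇒avoiding (exchanges j x) (≤-trans (m≤m+n 2 t) N≤count) b
    with y∉j , T , T≗ ← does-sound (exchangeable? j x y) ey = y , T , y≢b , y∉j , T≗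

  size-exchange : ∀ {x y j T} → B x j ≡ true → B y j ≡ false → col T ≗ swap (col j) x y → size T ≡ size j
  size-exchange {j = j} xj yj T≗ = trans (count-cong T≗) (count-swap (col j) xj yj)

  heavy⇒exchange-family : ∀ {x j} → Heavy x j →
    Σ (Fin t → Fin n) λ T → Injective _≡_ _≡_ T × (∀ p → B x (T p) ≡ false) ×
                            (∀ p {i} → i ≢ x → B i j ≡ true → B i (T p) ≡ true)
  heavy⇒exchange-family {x} {j} (xj , N≤count)
    with y , y-injective , ey ← ≤count⇒injection (exchanges j x) (≤-trans (m≤n+m t 2) N≤count) =
    T , T-injective , (λ p → trans (T≗ p x) (swap-at-x (col j) x (y p))) , T⊇j
    where
    exchange : ∀ p → Exchangeable j x (y p)
    exchange p = does-sound (exchangeable? j x (y p)) (ey p)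
    T = λ p → proj₁ (proj₂ (exchange p))
    T≗ = λ p → proj₂ (proj₂ (exchange p))
    y∉j = λ p → proj₁ (exchange p)
    T⊇j : ∀ p {i} → i ≢ x → B i j ≡ true → B i (T p) ≡ true
    T⊇j p {i} i≢x ij = trans (T≗ p i) (trans (swap-elsewhere (col j) i≢x (≢-by-entry ij (y∉j p))) ij)
    T-injective : Injective _≡_ _≡_ T
    T-injective {p} {q} e with y p Fin.≟ y q
    ... | yes yp≡yq = y-injective yp≡yq
    ... | no  yp≢yq = contradiction (trans (sym yp∈Tp) (trans (cong (B (y p)) e) yp∉Tq)) λ ()
      where
      yp∈Tp = trans (T≗ p (y p)) (swap-at-y (col j) (≢-by-entry xj (y∉j p) ∘ sym))
      yp∉Tq = trans (T≗ q (y p)) (trans (swap-elsewhere (col j) (≢-by-entry xj (y∉j p) ∘ sym) yp≢yq) (y∉j p))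

  heavy-size-injective : ∀ {x j j'} → Heavy x j → Heavy x j' → size j ≡ size j' → j ≡ j'
  heavy-size-injective {x} {j} {j'} hj hj' size≡ with j Fin.≟ j'
  ... | yes j≡j' = j≡j'
  ... | no  j≢j'
    with b , bj' , bj ← equal-size-difference size≡ j≢j'
    with y , T , y≢b , yj , T≗ ← exchange-avoiding hj b = contradiction
      (distinct⇒2≤count (col j' ∖ col T) (∖-intro (col j') (col T) (proj₁ hj') xT) (∖-intro (col j') (col T) bj' bT)
                        (≢-by-entry (proj₁ hj) bj))
      (equal-size-differ-once {j'} {T} (trans (sym size≡) (sym (size-exchange (proj₁ hj) yj T≗))))
    where
    xT : B x T ≡ false
    xT = trans (T≗ x) (swap-at-x (col j) x y)
    bT : B b T ≡ false
    bT = trans (T≗ b) (trans (swap-elsewhere (col j) (≢-by-entry (proj₁ hj) bj ∘ sym) (y≢b ∘ sym)) bj)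

  heavy-⊆ : ∀ {x j j'} → Heavy x j → Heavy x j' → size j + 2 ≤ size j' → col j ⊆ col j'
  heavy-⊆ {x} {j} {j'} hj hj' gap a aj with B a j' in aj'
  ... | true  = refl
  ... | false with y , T , y≢a , yj' , T≗ ← exchange-avoiding hj' a =
    contradiction (j∖T , T∖j) (no-crossing j T)
    where
    a≢x : a ≢ x
    a≢x = ≢-by-entry (proj₁ hj') aj' ∘ sym
    aT : B a T ≡ false
    aT = trans (T≗ a) (trans (swap-elsewhere (col j') a≢x (y≢a ∘ sym)) aj')
    xT : B x T ≡ false
    xT = trans (T≗ x) (swap-at-x (col j') x y)
    j∖T : 2 ≤ count (col j ∖ col T)
    j∖T = distinct⇒2≤count (col j ∖ col T) (∖-intro (col j) (col T) aj aT) (∖-intro (col j) (col T) (proj₁ hj) xT) a≢x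
    T∖j : 2 ≤ count (col T ∖ col j)
    T∖j = +-cancelˡ-≤ (size j) 2 _ (begin
      size j + 2                  ≤⟨ gap ⟩
      size j'                     ≡⟨ size-exchange (proj₁ hj') yj' T≗ ⟨
      size T                      ≤⟨ count-≤-∖ (col j) (col T) ⟩
      size j + count (col T ∖ col j) ∎)
      where open ≤-Reasoning

  module HeavyRank (x : Fin m) where

    -- Within one parity class sizes differ by at least two, as heavy-⊆ requires.
    _⊏_ : Fin n → Fin n → Set
    i ⊏ j = Heavy x i × size i < size j × parity (size i) ≡ parity (size j)

    _⊏?_ : ∀ i j → Dec (i ⊏ j)
    i ⊏? j = heavy? x i ×-dec (size i <? size j) ×-dec (parity (size i) Fin.≟ parity (size j))

    ⊏-trans : ∀ {i j l} → i ⊏ j → j ⊏ l → i ⊏ l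
    ⊏-trans (hi , i<j , i~j) (_ , j<l , j~l) = hi , <-trans i<j j<l , trans i~j j~l

    ⊏-irrefl : ∀ {i} → ¬ i ⊏ i
    ⊏-irrefl (_ , i<i , _) = <-irrefl refl i<i

    open Rank _⊏?_ ⊏-trans ⊏-irrefl public

    ⊏-gap : ∀ {i j} → i ⊏ j → size i + 2 ≤ size j
    ⊏-gap {i} {j} (_ , i<j , i~j) = subst (_≤ size j) (+-comm 2 (size i)) (same-parity⇒2+≤ i<j i~j)

    ⊏⇒⊆ : ∀ {i j} → i ⊏ j → Heavy x j → col i ⊆ col j
    ⊏⇒⊆ i⊏j hj = heavy-⊆ (proj₁ i⊏j) hj (⊏-gap i⊏j)

    ⊏⇒2≤∖ : ∀ {i j} → i ⊏ j → 2 ≤ count (col j ∖ col i)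
    ⊏⇒2≤∖ {i} {j} i⊏j = +-cancelˡ-≤ (size i) 2 _ (≤-trans (⊏-gap i⊏j) (count-≤-∖ (col i) (col j)))

  repeated-below : ∀ {x j M i₁ i₂} → Heavy x j → B x M ≡ true →
                   (L : Fin t → Fin n) → Injective _≡_ _≡_ L → (∀ p → B x (L p) ≡ true) → (∀ p → col (L p) ⊆ col M) →
                   i₁ ≢ i₂ → B i₁ j ≡ true → B i₁ M ≡ false → B i₂ j ≡ true → B i₂ M ≡ false → Repeated-F0210 t B
  repeated-below {x} {j} {M} {i₁} {i₂} hj xM L L-injective xL L⊆M i₁≢i₂ i₁j i₁M i₂j i₂M
    with T , T-injective , xT , T⊇j ← heavy⇒exchange-family hj = record
    { row₁ = i₁ ; row₂ = i₂ ; row₃ = x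
    ; row₁≢row₂ = i₁≢i₂ ; row₁≢row₃ = ≢-by-entry xM i₁M ∘ sym ; row₂≢row₃ = ≢-by-entry xM i₂M ∘ sym
    ; upper = T ; lower = L ; upper-injective = T-injective ; lower-injective = L-injective
    ; upper₁ = λ p → T⊇j p (≢-by-entry xM i₁M ∘ sym) i₁j
    ; upper₂ = λ p → T⊇j p (≢-by-entry xM i₂M ∘ sym) i₂j
    ; upper₃ = xT
    ; lower₁ = λ p → ⊆-false (L⊆M p) i₁M
    ; lower₂ = λ p → ⊆-false (L⊆M p) i₂M
    ; lower₃ = xL
    }

  chain⇒repeated : ∀ {x j} → Heavy x j → (g : Fin (suc t) → Fin n) → Injective _≡_ _≡_ g →
                   (∀ a → HeavyRank._⊏_ x (g a) j) → Repeated-F0210 t B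
  chain⇒repeated {x} {j} hj g g-injective g⊏j
    with i₀ , largest ← argmax (size ∘ g)
    with i₁ , i₂ , i₁∈ , i₂∈ , i₁≢i₂ ← 2≤count⇒distinct (col j ∖ col (g i₀)) (HeavyRank.⊏⇒2≤∖ x (g⊏j i₀)) =
    repeated-below hj (proj₁ (proj₁ (g⊏j i₀))) L (Finₚ.punchIn-injective i₀ _ _ ∘ g-injective)
      (λ p → proj₁ (proj₁ (g⊏j (punchIn i₀ p)))) (λ p → ⊏⇒⊆ (L⊏M p) (proj₁ (g⊏j i₀)))
      i₁≢i₂ (proj₁ (∖-elim (col j) (col M) i₁∈)) (proj₂ (∖-elim (col j) (col M) i₁∈))
            (proj₁ (∖-elim (col j) (col M) i₂∈)) (proj₂ (∖-elim (col j) (col M) i₂∈))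
    where
    open HeavyRank x
    M = g i₀
    L = g ∘ punchIn i₀
    L⊏M : ∀ p → L p ⊏ M
    L⊏M p = proj₁ (g⊏j (punchIn i₀ p)) , ≤∧≢⇒< (largest (punchIn i₀ p)) L≢M ,
            trans (proj₂ (proj₂ (g⊏j (punchIn i₀ p)))) (sym (proj₂ (proj₂ (g⊏j i₀))))
      where
      L≢M : size (L p) ≢ size M
      L≢M e = Finₚ.punchInᵢ≢i i₀ p (g-injective (heavy-size-injective (proj₁ (g⊏j (punchIn i₀ p))) (proj₁ (g⊏j i₀)) e))

  abstract
    heavy-rank-≤ : ∀ {x j} → Heavy x j → HeavyRank.rank x j ≤ t
    heavy-rank-≤ {x} hj = ≮⇒≥ λ t<rank →
      let g , g-injective , g⊏j = HeavyRank.predecessors x t<rank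
      in  no-repeated (chain⇒repeated hj g g-injective g⊏j)

  heavy-code : ∀ {x j} → Heavy x j → Fin (m * (2 * suc t))
  heavy-code {x} {j} hj = combine x (combine (parity (size j)) (fromℕ< (s≤s (heavy-rank-≤ hj))))

  heavy-code-injective : ∀ {x j x' j'} (hj : Heavy x j) (hj' : Heavy x' j') → heavy-code hj ≡ heavy-code hj' → j ≡ j'
  heavy-code-injective {x} {j} {x'} {j'} hj hj' e
    with refl , e' ← Finₚ.combine-injective x _ x' _ e
    with same-parity , same-rank ← Finₚ.combine-injective _ _ _ _ e' =
    HeavyRank.rank-injective x comparable
      (fromℕ<-injective (s≤s (heavy-rank-≤ hj)) (s≤s (heavy-rank-≤ hj')) same-rank)
    where
    comparable : HeavyRank._⊏_ x j j' ⊎ j ≡ j' ⊎ HeavyRank._⊏_ x j' j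
    comparable with <-cmp (size j) (size j')
    ... | tri< j<j' _ _ = inj₁ (hj , j<j' , same-parity)
    ... | tri≈ _ size≡ _ = inj₂ (inj₁ (heavy-size-injective hj hj' size≡))
    ... | tri> _ _ j'<j = inj₂ (inj₂ (hj' , j'<j , sym same-parity))

-- Bounding the number of columns

module Classification {m n} (t : ℕ) (A : Mat m n) (simple : Simple A)
                      (no-F0220 : ¬ F 0 2 2 0 ≺ A) (no-tF0210 : ¬ (t · F 0 2 1 0) ≺ A) where

  open HeavyColumns t A simple (λ _ _ → no-F0220 ∘ crossing⇒F0220≺ {B = A}) (no-tF0210 ∘ repeated-F0210⇒≺ {B = A})
  module Aᶜ = HeavyColumns t (complement A) (complement-simple simple)
                (λ j j' → no-F0220 ∘ crossing⇒F0220≺ {B = A} ∘ complement-crossing {B = A} {j} {j'})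
                (no-tF0210 ∘ repeated-F0210⇒≺ {B = A} ∘ complement-repeated {B = A})

  Typed : Fin n → Set
  Typed j = (∃ λ x → Heavy x j) ⊎ (∃ λ x → Aᶜ.Heavy x j)

  typed? : ∀ j → Dec (Typed j)
  typed? j = Finₚ.any? (λ x → heavy? x j) ⊎-dec Finₚ.any? (λ x → Aᶜ.heavy? x j)

  equal-size-family⇒typed : ∀ {j} (h : Fin (suc N) → Fin n) → Injective _≡_ _≡_ h →
                            (∀ p → h p ≢ j) → (∀ p → size (h p) ≡ size j) → Typed j
  equal-size-family⇒typed {j} h h-injective h≢j size≡ = from-common (pairwise-sharing⇒common Fin._≟_ a b share)
    where
    exchange = λ p → equal-size-exchange (sym (size≡ p)) (h≢j p ∘ sym)
    a = λ p → proj₁ (exchange p)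
    b = λ p → proj₁ (proj₂ (exchange p))
    a∈j = λ p → proj₁ (proj₂ (proj₂ (exchange p)))
    b∉j = λ p → proj₁ (proj₂ (proj₂ (proj₂ (exchange p))))
    h≗ = λ p → proj₂ (proj₂ (proj₂ (proj₂ (exchange p))))
    share : ∀ p q → a p ≡ a q ⊎ b p ≡ b q
    share p q = exchanges-share (a∈j p) (b∉j p) (a∈j q) (b∉j q) (h≗ p) (h≗ q)
    from-common : (∀ p → a p ≡ a zero) ⊎ (∀ p → b p ≡ b zero) → Typed j
    from-common (inj₁ all-a) = inj₁ (a zero , many-exchanges⇒heavy (n≤1+n N) (a∈j zero) h h-injective b b∉j
      λ p i → trans (h≗ p i) (cong (λ x → swap (col j) x (b p) i) (all-a p)))
    from-common (inj₂ all-b) = inj₂ (b zero , Aᶜ.many-exchanges⇒heavy (n≤1+n N) (cong not (b∉j zero)) h h-injective a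
      (λ p → cong not (a∈j p))
      λ p i → trans (cong not (h≗ p i)) (trans (not-swap (col j) (≢-by-entry (a∈j p) (b∉j p)) i)
                                                (cong (λ y → swap (not ∘ col j) y (a p) i) (all-b p))))

  module UntypedRank where

    _⊏_ : Fin n → Fin n → Set
    i ⊏ j = ¬ Typed i × size i ≡ size j × i Fin.< j

    _⊏?_ : ∀ i j → Dec (i ⊏ j)
    i ⊏? j = ¬? (typed? i) ×-dec (size i ≟ size j) ×-dec (i Finₚ.<? j)

    ⊏-trans : ∀ {i j l} → i ⊏ j → j ⊏ l → i ⊏ l
    ⊏-trans (¬ti , i~j , i<j) (_ , j~l , j<l) = ¬ti , trans i~j j~l , Finₚ.<-trans i<j j<l

    ⊏-irrefl : ∀ {i} → ¬ i ⊏ i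
    ⊏-irrefl (_ , _ , i<i) = Finₚ.<-irrefl refl i<i

    open Rank _⊏?_ ⊏-trans ⊏-irrefl public

  abstract
    untyped-rank-≤ : ∀ {j} → ¬ Typed j → UntypedRank.rank j ≤ N
    untyped-rank-≤ ¬typed = ≮⇒≥ λ N<rank →
      let g , g-injective , g⊏j = UntypedRank.predecessors N<rank
      in  ¬typed (equal-size-family⇒typed g g-injective (λ p → Finₚ.<⇒≢ (proj₂ (proj₂ (g⊏j p))))
                                                        (λ p → proj₁ (proj₂ (g⊏j p))))

  untyped-code : ∀ {j} → ¬ Typed j → Fin (suc m * suc N)
  untyped-code {j} ¬typed = combine (fromℕ< (s≤s (count-≤ (col j)))) (fromℕ< (s≤s (untyped-rank-≤ ¬typed)))

  untyped-code-injective : ∀ {j j'} (¬tj : ¬ Typed j) (¬tj' : ¬ Typed j') → untyped-code ¬tj ≡ untyped-code ¬tj' → j ≡ j'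
  untyped-code-injective {j} {j'} ¬tj ¬tj' e with same-size , same-rank ← Finₚ.combine-injective _ _ _ _ e =
    UntypedRank.rank-injective comparable (fromℕ<-injective (s≤s (untyped-rank-≤ ¬tj)) (s≤s (untyped-rank-≤ ¬tj')) same-rank)
    where
    size≡ : size j ≡ size j'
    size≡ = fromℕ<-injective (s≤s (count-≤ (col j))) (s≤s (count-≤ (col j'))) same-size
    comparable : UntypedRank._⊏_ j j' ⊎ j ≡ j' ⊎ UntypedRank._⊏_ j' j
    comparable with Finₚ.<-cmp j j'
    ... | tri< j<j' _ _ = inj₁ (¬tj , size≡ , j<j')
    ... | tri≈ _ j≡j' _ = inj₂ (inj₁ j≡j')
    ... | tri> _ _ j'<j = inj₂ (inj₂ (¬tj' , sym size≡ , j'<j))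

  H U : ℕ
  H = m * (2 * suc t)
  U = suc m * suc N

  code : ∀ j → Dec (Typed j) → Fin H ⊎ Fin H ⊎ Fin U
  code j (yes (inj₁ (_ , hj))) = inj₁ (heavy-code hj)
  code j (yes (inj₂ (_ , hj))) = inj₂ (inj₁ (Aᶜ.heavy-code hj))
  code j (no ¬typed)           = inj₂ (inj₂ (untyped-code ¬typed))

  code-injective : ∀ {j j'} d d' → code j d ≡ code j' d' → j ≡ j'
  code-injective (yes (inj₁ (_ , hj))) (yes (inj₁ (_ , hj'))) e = heavy-code-injective hj hj' (inj₁-injective e)
  code-injective (yes (inj₂ (_ , hj))) (yes (inj₂ (_ , hj'))) e =
    Aᶜ.heavy-code-injective hj hj' (inj₁-injective (inj₂-injective e))
  code-injective (no ¬tj)              (no ¬tj')              e =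
    untyped-code-injective ¬tj ¬tj' (inj₂-injective (inj₂-injective e))
  code-injective (yes (inj₁ _)) (yes (inj₂ _)) ()
  code-injective (yes (inj₁ _)) (no _)         ()
  code-injective (yes (inj₂ _)) (yes (inj₁ _)) ()
  code-injective (yes (inj₂ _)) (no _)         ()
  code-injective (no _)         (yes (inj₁ _)) ()
  code-injective (no _)         (yes (inj₂ _)) ()

  columns-≤ : n ≤ H + (H + U)
  columns-≤ = Finₚ.injective⇒≤ {f = join H (H + U) ∘ map₂ (join H U) ∘ λ j → code j (typed? j)}
    λ {j} {j'} e → code-injective (typed? j) (typed? j') (join₃-injective H H U e)

codes-≤ : ∀ m a b → 1 ≤ m → m * a + (m * a + suc m * b) ≤ (2 * a + 2 * b) * m
codes-≤ m a b 1≤m = begin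
  m * a + (m * a + suc m * b)   ≤⟨ +-monoʳ-≤ (m * a) (+-monoʳ-≤ (m * a) (*-monoˡ-≤ b (+-monoˡ-≤ m 1≤m))) ⟩
  m * a + (m * a + (m + m) * b) ≡⟨ rearrange m a b ⟩
  (2 * a + 2 * b) * m           ∎
  where
  open ≤-Reasoning
  rearrange : ∀ m a b → m * a + (m * a + (m + m) * b) ≡ (2 * a + 2 * b) * m
  rearrange = solve-∀

lemma1 : (t : ℕ) → 1 ≤ t →
    ∃₂ λ (c m₀ : ℕ) → ∀ (m n : ℕ) → m₀ ≤ m → (A : Mat m n) → Simple A →
    ¬ (F 0 2 2 0 ≺ A) → ¬ ((t · F 0 2 1 0) ≺ A) → n ≤ c * m
lemma1 t _ = 2 * (2 * suc t) + 2 * (3 + t) , 1 , λ m n 1≤m A simple no-F0220 no-tF0210 →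
  ≤-trans (Classification.columns-≤ t A simple no-F0220 no-tF0210) (codes-≤ m (2 * suc t) (3 + t) 1≤m)
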